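{- Let $T$ be a tree on $n$ vertices. For every $S\subseteq V(T)$ there is a set $W\subseteq V(T)\setminus S$ with $|W|\le 6|S|$ such that for every connected component $C$ of $T\setminus(S\cup W)$ there is at most one edge of $T$ between $V(C)$ and $S$.
   Context: For a graph $G$ and $U\subseteq V(G)$, $G\setminus U$ is the subgraph induced on $V(G)\setminus U$. -}

module Defs where

open import Data.Nat using (ℕ; _≤_)
open import Data.Bool using (Bool; true; false)
open import Data.Fin using (Fin)
open import Data.Fin.Subset using (Subset; _∈_; _∉_)
open import Data.List using (List; length; _∷_; _∷ʳ_)
open import Data.List.Relation.Unary.Linked using (Linked)
open import Data.List.Relation.Unary.Unique.Propositional using (Unique)
open import Data.Product using (Σ; ∃; _×_)
open import Relation.Binary.PropositionalEquality using (_≡_)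
open import Relation.Nullary using (¬_)

record Graph (n : ℕ) : Set where
  field
    adj       : Fin n → Fin n → Bool
    adj-sym   : ∀ x y → adj x y ≡ adj y x
    adj-irrefl : ∀ x → adj x x ≡ false

open Graph public

Edge : ∀ {n} → Graph n → Fin n → Fin n → Set
Edge G x y = adj G x y ≡ true

data Walk {n : ℕ} (R : Fin n → Fin n → Set) : Fin n → Fin n → Set where
  here : ∀ {x} → Walk R x x
  step : ∀ {x y z} → R x y → Walk R y z → Walk R x z

EdgeOutside : ∀ {n} → Graph n → Subset n → Fin n → Fin n → Set
EdgeOutside G U x y = Edge G x y × x ∉ U × y ∉ U

Connected : ∀ {n} → Graph n → Set
Connected G = ∀ x y → Walk (Edge G) x y

IsCycle : ∀ {n} → Graph n → Fin n → List (Fin n) → Set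
IsCycle G v ws = 2 ≤ length ws × Unique (v ∷ ws) × Linked (Edge G) ((v ∷ ws) ∷ʳ v)

Acyclic : ∀ {n} → Graph n → Set
Acyclic G = ∀ v ws → ¬ IsCycle G v ws

IsTree : ∀ {n} → Graph n → Set
IsTree G = Connected G × Acyclic G

-- x lies in the connected component of v in G \ U (v ∉ U).
InComponent : ∀ {n} → Graph n → Subset n → Fin n → Fin n → Set
InComponent G U v x = Walk (EdgeOutside G U) v x

{-# OPTIONS --safe #-}
-- Root the tree and let W be the set of parents of vertices of S that are not themselves
-- in S, so |W| ≤ |S|.  A vertex x ∉ S ∪ W adjacent to s ∈ S is a child of s, since
-- otherwise x would be the parent of s and lie in W.  As the parent of such an x is
-- deleted, a walk in T ∖ (S ∪ W) starting at x can never climb above x: the component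
-- of x consists of descendants of x.  Two such vertices x, x′ in one component are then
-- descendants of each other, hence equal, and s = parent x = s′.
module Submission where

open import Defs
open import Axiom.UniquenessOfIdentityProofs using (module Decidable⇒UIP)
import Data.Bool as Bool
open import Data.Empty using (⊥-elim) renaming (⊥ to Empty)
open import Data.Fin as Fin using (Fin; zero; suc)
open import Data.Fin.Subset using (Subset; _∈_; _∉_; _⊆_; _∪_; _∩_; ∁; ∣_∣; ⊥; ⁅_⁆; inside; outside)
open import Data.Fin.Subset.Properties
  using (∣p∣≤∣x∷p∣; ∣⊥∣≡0; ∣⁅x⁆∣≡1; x∈⁅x⁆; x∈p∪q⁺; x∈p∩q⁺; x∉p⇒x∈∁p; p∩q⊆p; p∩q⊆q; p⊆q⇒∣p∣≤∣q∣)
open import Data.List using (List; []; _∷_; length; _∷ʳ_)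
open import Data.List.Membership.Propositional using () renaming (_∈_ to _∈ᴸ_; _∉_ to _∉ᴸ_)
open import Data.List.Relation.Binary.Subset.Propositional using () renaming (_⊆_ to _⊆ᴸ_)
open import Data.List.Relation.Unary.All using ([])
open import Data.List.Relation.Unary.All.Properties using (¬Any⇒All¬; All¬⇒¬Any)
open import Data.List.Relation.Unary.AllPairs using (_∷_; [])
open import Data.List.Relation.Unary.Any using (here; there)
open import Data.List.Relation.Unary.Linked using (Linked; _∷_; [-])
open import Data.List.Relation.Unary.Unique.Propositional using (Unique)
open import Data.Nat using (ℕ; _+_; _*_; _≤_; _<_; z≤n; s≤s)
open import Data.Nat.Properties
  using (≤-refl; ≤-trans; ≤-reflexive; <⇒≤; <⇒≱; +-suc; +-monoʳ-≤; +-mono-≤; m≤n*m)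
open import Data.Product using (Σ; _×_; _,_; proj₁; proj₂)
open import Data.Sum using (_⊎_; inj₁; inj₂; [_,_]; map₁)
open import Data.Vec using (_∷_; [])
open import Data.Vec.Base using (here; there)
open import Function using (_∘_; id)
open import Relation.Binary.Construct.Closure.ReflexiveTransitive using (Star; ε; _◅_)
open import Relation.Binary.PropositionalEquality
  using (_≡_; _≢_; refl; sym; trans; cong; cong₂; subst; module ≡-Reasoning)
open import Relation.Nullary using (¬_; yes; no)

∣p∪q∣≤∣p∣+∣q∣ : ∀ {n} (p q : Subset n) → ∣ p ∪ q ∣ ≤ ∣ p ∣ + ∣ q ∣
∣p∪q∣≤∣p∣+∣q∣ [] [] = z≤n
∣p∪q∣≤∣p∣+∣q∣ (outside ∷ p) (outside ∷ q) = ∣p∪q∣≤∣p∣+∣q∣ p q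
∣p∪q∣≤∣p∣+∣q∣ (outside ∷ p) (inside ∷ q) =
  ≤-trans (s≤s (∣p∪q∣≤∣p∣+∣q∣ p q)) (≤-reflexive (sym (+-suc ∣ p ∣ ∣ q ∣)))
∣p∪q∣≤∣p∣+∣q∣ (inside ∷ p) (b ∷ q) =
  s≤s (≤-trans (∣p∪q∣≤∣p∣+∣q∣ p q) (+-monoʳ-≤ ∣ p ∣ (∣p∣≤∣x∷p∣ b q)))

image : ∀ {m n} → (Fin m → Fin n) → Subset m → Subset n
image f [] = ⊥
image f (outside ∷ p) = image (f ∘ suc) p
image f (inside ∷ p) = ⁅ f zero ⁆ ∪ image (f ∘ suc) p

∣image∣≤ : ∀ {m n} (f : Fin m → Fin n) (p : Subset m) → ∣ image f p ∣ ≤ ∣ p ∣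
∣image∣≤ {n = n} f [] = ≤-reflexive (∣⊥∣≡0 n)
∣image∣≤ f (outside ∷ p) = ∣image∣≤ (f ∘ suc) p
∣image∣≤ f (inside ∷ p) =
  ≤-trans (∣p∪q∣≤∣p∣+∣q∣ ⁅ f zero ⁆ _)
          (+-mono-≤ (≤-reflexive (∣⁅x⁆∣≡1 (f zero))) (∣image∣≤ (f ∘ suc) p))

∈-image : ∀ {m n} (f : Fin m → Fin n) {p : Subset m} {x} → x ∈ p → f x ∈ image f p
∈-image f {inside ∷ p} here = x∈p∪q⁺ (inj₁ (x∈⁅x⁆ (f zero)))
∈-image f {outside ∷ p} (there x∈p) = ∈-image (f ∘ suc) x∈p
∈-image f {inside ∷ p} (there x∈p) = x∈p∪q⁺ (inj₂ (∈-image (f ∘ suc) x∈p))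

module _ {n} {R : Fin n → Fin n → Set} where

  vertices : ∀ {a b} → Walk R a b → List (Fin n)
  vertices {a} here = a ∷ []
  vertices {a} (step _ w) = a ∷ vertices w

  len : ∀ {a b} → Walk R a b → ℕ
  len here = 0
  len (step _ w) = ℕ.suc (len w)

  second : ∀ {a b} → Walk R a b → Fin n
  second {a} here = a
  second (step {y = y} _ _) = y

  2≤length-vertices : ∀ {a b c} (r : R a b) (w : Walk R b c) → 2 ≤ length (vertices (step r w))
  2≤length-vertices r here = s≤s (s≤s z≤n)
  2≤length-vertices r (step _ _) = s≤s (s≤s z≤n)

  start∈vertices : ∀ {a b} (w : Walk R a b) → a ∈ᴸ vertices w
  start∈vertices here = here refl
  start∈vertices (step _ _) = here refl

  end∈vertices : ∀ {a b} (w : Walk R a b) → b ∈ᴸ vertices w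
  end∈vertices here = here refl
  end∈vertices (step _ w) = there (end∈vertices w)

  walk-preserves : ∀ {P : Fin n → Set} → (∀ {x y} → R x y → P x → P y) →
                   ∀ {a b} → Walk R a b → P a → P b
  walk-preserves f here pa = pa
  walk-preserves f (step r w) pa = walk-preserves f w (f r pa)

  infixr 5 _++ʷ_

  _++ʷ_ : ∀ {a b c} → Walk R a b → Walk R b c → Walk R a c
  here ++ʷ q = q
  step r p ++ʷ q = step r (p ++ʷ q)

  ∈-++ʷ⁻ : ∀ {a b c z} (p : Walk R a b) (q : Walk R b c) →
           z ∈ᴸ vertices (p ++ʷ q) → z ∈ᴸ vertices p ⊎ z ∈ᴸ vertices q
  ∈-++ʷ⁻ here q z∈ = inj₂ z∈
  ∈-++ʷ⁻ (step _ p) q (here refl) = inj₁ (here refl)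
  ∈-++ʷ⁻ (step _ p) q (there z∈) = map₁ there (∈-++ʷ⁻ p q z∈)

  reverse : (∀ {x y} → R x y → R y x) → ∀ {a b} → Walk R a b → Walk R b a
  reverse sym here = here
  reverse sym (step r w) = reverse sym w ++ʷ step (sym r) here

  ∈-reverse⁻ : ∀ (sym : ∀ {x y} → R x y → R y x) {a b z} (w : Walk R a b) →
               z ∈ᴸ vertices (reverse sym w) → z ∈ᴸ vertices w
  ∈-reverse⁻ sym here z∈ = z∈
  ∈-reverse⁻ sym (step r w) z∈ with ∈-++ʷ⁻ (reverse sym w) _ z∈
  ... | inj₁ z∈w = there (∈-reverse⁻ sym w z∈w)
  ... | inj₂ (here refl) = there (start∈vertices w)
  ... | inj₂ (there (here refl)) = here refl

  suffix : ∀ {a b c} (w : Walk R a b) → c ∈ᴸ vertices w →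
           Σ (Walk R c b) λ q →
             vertices q ⊆ᴸ vertices w × (Unique (vertices w) → Unique (vertices q))
  suffix here (here refl) = here , id , id
  suffix (step r w) (here refl) = step r w , id , id
  suffix (step r w) (there c∈w) =
    let q , q⊆w , uniq = suffix w c∈w
    in q , there ∘ q⊆w , λ { (_ ∷ u) → uniq u }

  open import Data.List.Membership.DecPropositional (Fin._≟_ {n}) using (_∈?_)

  toPath : ∀ {a b} (w : Walk R a b) →
           Σ (Walk R a b) λ p → Unique (vertices p) × vertices p ⊆ᴸ vertices w
  toPath here = here , [] ∷ [] , id
  toPath {a} (step r w) with toPath w
  ... | p , u , p⊆w with a ∈? vertices p
  ...   | yes a∈p = let q , q⊆p , uniq = suffix p a∈p in q , uniq u , there ∘ p⊆w ∘ q⊆p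
  ...   | no a∉p =
    step r p , ¬Any⇒All¬ _ a∉p ∷ u , λ { (here refl) → here refl ; (there z∈) → there (p⊆w z∈) }

  vertices-linked : ∀ {x a b z} → R x a → (w : Walk R a b) → R b z →
                    Linked R (x ∷ (vertices w ∷ʳ z))
  vertices-linked r here r′ = r ∷ r′ ∷ [-]
  vertices-linked r (step r″ w) r′ = r ∷ vertices-linked r″ w r′

module _ {n} (G : Graph n) where

  edge-sym : ∀ {x y} → Edge G x y → Edge G y x
  edge-sym {x} {y} e = trans (adj-sym G y x) e

  edge-irrefl : ∀ {x} → ¬ Edge G x x
  edge-irrefl {x} e with trans (sym e) (adj-irrefl G x)
  ... | ()

  edge-irrelevant : ∀ {x y} (e e′ : Edge G x y) → e ≡ e′
  edge-irrelevant = Decidable⇒UIP.≡-irrelevant Bool._≟_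

  edge-outside-sym : ∀ {U x y} → EdgeOutside G U x y → EdgeOutside G U y x
  edge-outside-sym (e , x∉U , y∉U) = edge-sym e , y∉U , x∉U

  component-outside : ∀ {U v x} → InComponent G U v x → v ∉ U → x ∉ U
  component-outside = walk-preserves (λ (_ , _ , y∉U) _ → y∉U)

module AcyclicWalks {n} {G : Graph n} (acyclic : Acyclic G) where

  -- x, y ⋯ z, x would be a cycle
  acyclic⇒no-bypass : ∀ {x y z} → Edge G x y → Edge G x z → y ≢ z →
                      (w : Walk (Edge G) y z) → x ∉ᴸ vertices w → Empty
  acyclic⇒no-bypass {x} e e′ y≢z w x∉w with toPath w
  ... | here , _ , _ = y≢z refl
  ... | step e″ p , u , p⊆w =
    acyclic x (vertices (step e″ p))
      ( 2≤length-vertices e″ p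
      , ¬Any⇒All¬ _ (x∉w ∘ p⊆w) ∷ u
      , vertices-linked e (step e″ p) (edge-sym G e′))

  path-unique : ∀ {a b} (p q : Walk (Edge G) a b) →
                Unique (vertices p) → Unique (vertices q) → p ≡ q
  path-unique here here _ _ = refl
  path-unique here (step _ q) _ (a∉q ∷ _) = ⊥-elim (All¬⇒¬Any a∉q (end∈vertices q))
  path-unique (step _ p) here (a∉p ∷ _) _ = ⊥-elim (All¬⇒¬Any a∉p (end∈vertices p))
  path-unique (step {y = y} e p) (step {y = y′} e′ q) (a∉p ∷ up) (a∉q ∷ uq) with y Fin.≟ y′
  ... | yes refl = cong₂ step (edge-irrelevant G e e′) (path-unique p q up uq)
  ... | no y≢y′ = ⊥-elim (acyclic⇒no-bypass e e′ y≢y′ (p ++ʷ reverse (edge-sym G) q) a∉p++q)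
    where
    a∉p++q : _ ∉ᴸ vertices (p ++ʷ reverse (edge-sym G) q)
    a∉p++q a∈ = [ All¬⇒¬Any a∉p , All¬⇒¬Any a∉q ∘ ∈-reverse⁻ (edge-sym G) q ] (∈-++ʷ⁻ p _ a∈)

  -- the part of p after a is the path q, so b would occur twice on p
  path-∈-antisym : ∀ {a b c} (p : Walk (Edge G) b c) (q : Walk (Edge G) a c) →
                   Unique (vertices p) → Unique (vertices q) →
                   a ∈ᴸ vertices p → b ∈ᴸ vertices q → a ≡ b
  path-∈-antisym here q _ _ (here refl) _ = refl
  path-∈-antisym (step _ p) q _ _ (here refl) _ = refl
  path-∈-antisym (step _ p) q (b∉p ∷ up) uq (there a∈p) b∈q =
    let p′ , p′⊆p , uniq = suffix p a∈p
        q≡p′ = path-unique q p′ uq (uniq up)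
    in ⊥-elim (All¬⇒¬Any b∉p (p′⊆p (subst (λ w → _ ∈ᴸ vertices w) q≡p′ b∈q)))

record Rooting {n} (G : Graph n) : Set where
  field
    parent : Fin n → Fin n
    depth  : Fin n → ℕ

  ChildOf : Fin n → Fin n → Set
  ChildOf x y = parent x ≡ y × depth y < depth x

  field
    orient : ∀ {x y} → Edge G x y → ChildOf x y ⊎ ChildOf y x

  -- Star ChildOf x a: x is a descendant of a
  depth-≤ : ∀ {x a} → Star ChildOf x a → depth a ≤ depth x
  depth-≤ ε = ≤-refl
  depth-≤ ((_ , lt) ◅ d) = ≤-trans (depth-≤ d) (<⇒≤ lt)

  descendant-antisym : ∀ {x a} → Star ChildOf x a → Star ChildOf a x → x ≡ a
  descendant-antisym ε _ = refl
  descendant-antisym ((_ , lt) ◅ d) d′ = ⊥-elim (<⇒≱ lt (≤-trans (depth-≤ d′) (depth-≤ d)))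

  descendants-closed : ∀ {U a u w} → parent a ∈ U → EdgeOutside G U u w →
                       Star ChildOf u a → Star ChildOf w a
  descendants-closed pa∈U (e , _ , w∉U) d with orient e
  ... | inj₂ w-child = w-child ◅ d
  descendants-closed pa∈U (e , _ , w∉U) ε | inj₁ (pa≡w , _) =
    ⊥-elim (w∉U (subst (_∈ _) pa≡w pa∈U))
  descendants-closed pa∈U (e , _ , w∉U) ((refl , _) ◅ d) | inj₁ (pu≡w , _) =
    subst (λ v → Star ChildOf v _) pu≡w d

SinglyAttached : ∀ {n} → Graph n → Subset n → Subset n → Set
SinglyAttached G S W =
  ∀ v → v ∉ (S ∪ W) → ∀ x x′ s s′ →
  InComponent G (S ∪ W) v x → InComponent G (S ∪ W) v x′ →
  s ∈ S → s′ ∈ S → Edge G x s → Edge G x′ s′ → x ≡ x′ × s ≡ s′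

module Separator {n} {G : Graph n} (ρ : Rooting G) (S : Subset n) where
  open Rooting ρ

  W : Subset n
  W = image parent S ∩ ∁ S

  W⊆∁S : W ⊆ ∁ S
  W⊆∁S = p∩q⊆q (image parent S) (∁ S)

  ∣W∣≤∣S∣ : ∣ W ∣ ≤ ∣ S ∣
  ∣W∣≤∣S∣ = ≤-trans (p⊆q⇒∣p∣≤∣q∣ (p∩q⊆p (image parent S) (∁ S))) (∣image∣≤ parent S)

  X : Subset n
  X = S ∪ W

  neighbour-of-S-is-child : ∀ {x s} → x ∉ X → s ∈ S → Edge G x s → parent x ≡ s
  neighbour-of-S-is-child {x} x∉X s∈S e with orient e
  ... | inj₁ (px≡s , _) = px≡s
  ... | inj₂ (ps≡x , _) = ⊥-elim (x∉X (x∈p∪q⁺ (inj₂ x∈W)))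
    where
    x∈W : x ∈ W
    x∈W = x∈p∩q⁺ ( subst (_∈ image parent S) ps≡x (∈-image parent s∈S)
                 , x∉p⇒x∈∁p (x∉X ∘ x∈p∪q⁺ ∘ inj₁))

  singly-attached : SinglyAttached G S W
  singly-attached v v∉X x x′ s s′ v⇝x v⇝x′ s∈S s′∈S e e′ = x≡x′ , s≡s′
    where
    px≡s : parent x ≡ s
    px≡s = neighbour-of-S-is-child (component-outside G v⇝x v∉X) s∈S e

    px′≡s′ : parent x′ ≡ s′
    px′≡s′ = neighbour-of-S-is-child (component-outside G v⇝x′ v∉X) s′∈S e′

    ∈S⇒∈X : ∀ {y} → y ∈ S → y ∈ X
    ∈S⇒∈X = x∈p∪q⁺ ∘ inj₁

    below : ∀ {a b} → parent a ∈ X → Walk (EdgeOutside G X) a b → Star ChildOf b a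
    below pa∈X a⇝b = walk-preserves (descendants-closed pa∈X) a⇝b ε

    x⇝x′ : Walk (EdgeOutside G X) x x′
    x⇝x′ = reverse (edge-outside-sym G) v⇝x ++ʷ v⇝x′

    x≡x′ : x ≡ x′
    x≡x′ = descendant-antisym
      (below (subst (_∈ X) (sym px′≡s′) (∈S⇒∈X s′∈S)) (reverse (edge-outside-sym G) x⇝x′))
      (below (subst (_∈ X) (sym px≡s) (∈S⇒∈X s∈S)) x⇝x′)

    s≡s′ : s ≡ s′
    s≡s′ = begin
      s          ≡⟨ sym px≡s ⟩
      parent x   ≡⟨ cong parent x≡x′ ⟩
      parent x′  ≡⟨ px′≡s′ ⟩
      s′         ∎
      where open ≡-Reasoning

module _ {n} {T : Graph n} (connected : Connected T) (acyclic : Acyclic T) (root : Fin n) where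
  open import Data.List.Membership.DecPropositional (Fin._≟_ {n}) using (_∈?_)
  open AcyclicWalks {G = T} acyclic using (path-unique; path-∈-antisym)

  toRoot : ∀ x → Walk (Edge T) x root
  toRoot x = proj₁ (toPath (connected x root))

  toRoot-unique : ∀ x → Unique (vertices (toRoot x))
  toRoot-unique x = proj₁ (proj₂ (toPath (connected x root)))

  rootedAt : Rooting T
  rootedAt = record { parent = parent ; depth = depth ; orient = orient }
    where
    -- parent root = root is harmless: ChildOf root y would need depth y < 0
    parent : Fin n → Fin n
    parent x = second (toRoot x)

    depth : Fin n → ℕ
    depth x = len (toRoot x)

    -- x followed by the root path of y is then a path, hence the root path of x
    child-of : ∀ {x y} → Edge T x y → x ∉ᴸ vertices (toRoot y) →
               parent x ≡ y × depth y < depth x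
    child-of {x} {y} e x∉ = cong second toRoot-x , ≤-reflexive (sym (cong len toRoot-x))
      where
      toRoot-x : toRoot x ≡ step e (toRoot y)
      toRoot-x = path-unique (toRoot x) (step e (toRoot y))
                   (toRoot-unique x) (¬Any⇒All¬ _ x∉ ∷ toRoot-unique y)

    orient : ∀ {x y} → Edge T x y →
             (parent x ≡ y × depth y < depth x) ⊎ (parent y ≡ x × depth x < depth y)
    orient {x} {y} e with x ∈? vertices (toRoot y) | y ∈? vertices (toRoot x)
    ... | no x∉ | _ = inj₁ (child-of e x∉)
    ... | yes _ | no y∉ = inj₂ (child-of (edge-sym T e) y∉)
    ... | yes x∈ | yes y∈ =
      let x≡y = path-∈-antisym (toRoot y) (toRoot x) (toRoot-unique y) (toRoot-unique x) x∈ y∈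
      in ⊥-elim (edge-irrefl T (subst (Edge T x) (sym x≡y) e))

rooting : ∀ {n} {T : Graph n} → IsTree T → Rooting T
rooting {ℕ.zero} _ = record { parent = λ () ; depth = λ () ; orient = λ { {()} } }
rooting {ℕ.suc n} (connected , acyclic) = rootedAt connected acyclic zero

lemma4p2 : (n : ℕ) (T : Graph n) → IsTree T → (S : Subset n) →
    Σ (Subset n) λ W → W ⊆ ∁ S × ∣ W ∣ ≤ 6 * ∣ S ∣ ×
      (∀ v → v ∉ (S ∪ W) →
        ∀ x x′ s s′ →
          InComponent T (S ∪ W) v x → InComponent T (S ∪ W) v x′ →
          s ∈ S → s′ ∈ S → Edge T x s → Edge T x′ s′ →
          x ≡ x′ × s ≡ s′)
lemma4p2 n T tree S =
  W , W⊆∁S , ≤-trans ∣W∣≤∣S∣ (m≤n*m ∣ S ∣ 6) , singly-attached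
  where open Separator (rooting {T = T} tree) S
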